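{- The generalised ant with rule word $LLRLRL$ has infinitely many highways. In particular, for every $n\in\mathbb{N}$, the ant $LLRLRL$ admits a highway of period $220+24n$.
   Context: A generalised ant with rule word $w=w_0w_1\cdots w_{|w|-1}\in\{L,R\}^+$ has state set $Q=\{\rightarrow,\uparrow,\leftarrow,\downarrow\}$ (the four unit vectors of $\mathbb{Z}^2$) and alphabet $A=\{0,1,\dots,|w|-1\}=\mathbb{Z}/|w|\mathbb{Z}$. A configuration is $(C,(i,j),d)\in A^{\mathbb{Z}^2}\times\mathbb{Z}^2\times Q$ (picture, ant position, ant direction). The transition $T_w(C,(i,j),d)=(C',(i',j'),d')$ is: $C'(i,j)=C(i,j)+1 \bmod |w|$ and $C'(k,l)=C(k,l)$ for $(k,l)\neq(i,j)$; $d'$ is $d$ rotated by $90^\circ$ clockwise if $w_{C(i,j)}=R$ and counterclockwise if $w_{C(i,j)}=L$; $(i',j')=(i,j)+d'$. A pattern is a map $P:S\to A$ with $S\subseteq\mathbb{Z}^2$ finite (its support); $T_w$ is applied to $(P,(i,j),d)$ by the same rule, provided $(i,j)\in S$. A highway of period $N$ and drift $(a,b)\in\mathbb{Z}^2$ of the ant $w$ is given by a pattern $P$ with support $S$, a position $(i,j)\in S$ and a direction $d$ such that $T_w$ can be applied $N$ times starting from $(P,(i,j),d)$ (the ant stays in $S$ before each application), the resulting pattern $T_w^N(P)$ has the ant at position $(i,j)+(a,b)$ with direction $d$, and for all $(x,y)\in S$: $P(x,y)=T_w^N(P)(x+a,y+b)$ if $(x+a,y+b)\in S$, and $P(x,y)=0$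 otherwise. (Thus if such a pattern appears in a configuration whose cells in direction $(a,b)$ from $S$ are all $0$, the ant's movement and trace are $N$-periodic forever.) Highways obtained from one another by rotation, translation, or by choosing another pattern along the same periodic evolution are regarded as the same highway. -}

module Defs where

open import Data.Nat using (ℕ; zero; suc)
open import Data.Nat.DivMod using (_mod_)
open import Data.Integer using (ℤ; +_; -[1+_]) renaming (_+_ to _+ℤ_)
open import Data.Fin using (Fin; toℕ)
open import Data.Vec using (Vec; lookup; _∷_; [])
open import Data.Product using (_×_; _,_; Σ; ∃)
open import Data.List using (List)
open import Data.List.Membership.Propositional using (_∈_; _∉_)
open import Relation.Binary.PropositionalEquality using (_≡_)
open import Relation.Nullary using (yes; no)
open import Data.Product.Properties using (≡-dec)
import Data.Integer.Properties as ℤP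

data Turn : Set where
  L R : Turn

data Dir : Set where
  east north west south : Dir

Pos : Set
Pos = ℤ × ℤ

vec : Dir → Pos
vec east  = (+ 1 , + 0)
vec north = (+ 0 , + 1)
vec west  = (-[1+ 0 ] , + 0)
vec south = (+ 0 , -[1+ 0 ])

_⊕_ : Pos → Pos → Pos
(a , b) ⊕ (c , d) = (a +ℤ c , b +ℤ d)

cw : Dir → Dir
cw east  = south
cw south = west
cw west  = north
cw north = east

ccw : Dir → Dir
ccw east  = north
ccw north = west
ccw west  = south
ccw south = east

turn : Turn → Dir → Dir
turn R = cw
turn L = ccw

_≟P_ : (p q : Pos) → Relation.Nullary.Dec (p ≡ q)
_≟P_ = ≡-dec ℤP._≟_ ℤP._≟_

-- A rule word w of length suc k; the alphabet is Fin (suc k) = ℤ/|w|ℤ.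
-- A (pattern) picture is a colouring of ℤ² (only its values on the support matter).
Picture : ℕ → Set
Picture k = Pos → Fin (suc k)

inc : ∀ {k} → Fin (suc k) → Fin (suc k)
inc {k} i = suc (toℕ i) mod (suc k)

Config : ℕ → Set
Config k = Picture k × Pos × Dir

step : ∀ {k} → Vec Turn (suc k) → Config k → Config k
step w (C , p , d) = (C' , p ⊕ vec d' , d')
  where
  d' = turn (lookup w (C p)) d
  C' : Picture _
  C' q with q ≟P p
  ... | yes _ = inc (C p)
  ... | no  _ = C q

iterate : ∀ {k} → Vec Turn (suc k) → ℕ → Config k → Config k
iterate w zero    c = c
iterate w (suc n) c = iterate w n (step w c)

position : ∀ {k} → Config k → Pos
position (_ , p , _) = p

Applicable : ∀ {k} → Vec Turn (suc k) → List Pos → ℕ → Config k → Set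
Applicable w S zero    c = Data.Unit.⊤ where import Data.Unit
Applicable w S (suc n) c = (position c ∈ S) × Applicable w S n (step w c)

IsHighway : ∀ {k} → Vec Turn (suc k) → ℕ → Pos → List Pos → Picture k → Pos → Dir → Set
IsHighway {k} w N v S P p d =
  (p ∈ S) ×
  Applicable w S N (P , p , d) ×
  (let (P' , p' , d') = iterate w N (P , p , d) in
     (p' ≡ p ⊕ v) × (d' ≡ d) ×
     (∀ x → x ∈ S →
        ((x ⊕ v) ∈ S → P x ≡ P' (x ⊕ v)) ×
        ((x ⊕ v) ∉ S → P x ≡ Data.Fin.zero)))

HasHighwayOfPeriod : ∀ {k} → Vec Turn (suc k) → ℕ → Set
HasHighwayOfPeriod {k} w N =
  Σ Pos λ v → Σ (List Pos) λ S → Σ (Picture k) λ P → Σ Pos λ p → Σ Dir λ d →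
    IsHighway w N v S P p d

LLRLRL : Vec Turn 6
LLRLRL = L ∷ L ∷ R ∷ L ∷ R ∷ L ∷ []

-- A highway is certified by running the ant on a finite pattern, kept as a zipper of rows
-- around the ant: after N steps the ant must have moved by (2, -2) with its direction
-- restored, and every cell of the pattern must reappear translated by (2, -2), or be 0 if
-- it leaves the support. For n ≤ 4 this is a single closed computation. The pattern for
-- n = 4 + k contains a stripe of 2k identical rows, which the ant crosses four times, and
-- each crossing of a pair of rows takes 12, 4, 4 and 4 steps whatever lies beyond the
-- pair. So for k ≥ 1 the crossings can be iterated symbolically; together with five fixed
-- phases of 340 steps in all this gives a run of 340 + 24 (n - 5) = 220 + 24 n steps.

module Submission where

open import Data.Bool using (Bool; true; false; T; _∧_)
open import Data.Bool.Properties using (T-∧; T-≡)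
open import Data.Empty using (⊥-elim)
open import Data.Fin using (Fin; zero; #_)
import Data.Fin.Properties as Fin
open import Data.Integer using (+_; -[1+_]; -_; _⊖_) renaming (_+_ to _+ℤ_)
import Data.Integer.Properties as ℤ
open import Data.List using (List; []; _∷_; _++_; _ʳ++_; length; reverse; replicate; concat; map; take; drop)
open import Data.List.Properties using (++-assoc; ++-identityʳ; length-++)
open import Data.List.Membership.Propositional using (_∈_; _∉_)
open import Data.List.Membership.Propositional.Properties using (∈-++⁺ˡ; ∈-++⁺ʳ; ∈-++⁻)
open import Data.List.Relation.Unary.Any using (here; there)
open import Data.Maybe using (Maybe; just; nothing; is-just; fromMaybe; _>>=_)
import Data.Maybe as Maybe
open import Data.Maybe.Properties using (just-injective)
open import Data.Nat using (ℕ; zero; suc; _+_; _*_)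
import Data.Nat.Properties as ℕ
open import Data.Nat.Show using (readMaybe)
open import Data.Nat.Tactic.RingSolver using (solve-∀)
open import Data.Product using (_×_; _,_; proj₁; proj₂; ∃; ∃₂)
open import Data.String using (String; toList; fromChar)
open import Data.Sum using (inj₁; inj₂)
open import Data.Unit using (tt)
open import Data.Vec using (Vec; lookup)
open import Function using (_∘_; Equivalence)
open import Relation.Binary.PropositionalEquality
open import Relation.Nullary using (Dec; yes; no)
open import Relation.Nullary.Decidable using (⌊_⌋; toWitness)

open import Defs

T-is-just : ∀ {A : Set} {m : Maybe A} → T (is-just m) → ∃ λ x → m ≡ just x
T-is-just {m = just x} _ = x , refl

module _ {A : Set} where

  lookupOr : A → List A → ℕ → A
  lookupOr d []       _       = d
  lookupOr d (x ∷ xs) zero    = x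
  lookupOr d (x ∷ xs) (suc i) = lookupOr d xs i

  modifyAt : List A → ℕ → (A → A) → List A
  modifyAt []       _       f = []
  modifyAt (x ∷ xs) zero    f = f x ∷ xs
  modifyAt (x ∷ xs) (suc i) f = x ∷ modifyAt xs i f

  lookupOr-modifyAt-≡ : ∀ {d f} xs i → f d ≡ d → lookupOr d (modifyAt xs i f) i ≡ f (lookupOr d xs i)
  lookupOr-modifyAt-≡ []       i       fd≡d = sym fd≡d
  lookupOr-modifyAt-≡ (x ∷ xs) zero    fd≡d = refl
  lookupOr-modifyAt-≡ (x ∷ xs) (suc i) fd≡d = lookupOr-modifyAt-≡ xs i fd≡d

  lookupOr-modifyAt-≢ : ∀ {d f} xs {i j} → j ≢ i → lookupOr d (modifyAt xs i f) j ≡ lookupOr d xs j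
  lookupOr-modifyAt-≢ []       j≢i = refl
  lookupOr-modifyAt-≢ (x ∷ xs) {zero}  {zero}  j≢i = ⊥-elim (j≢i refl)
  lookupOr-modifyAt-≢ (x ∷ xs) {zero}  {suc j} j≢i = refl
  lookupOr-modifyAt-≢ (x ∷ xs) {suc i} {zero}  j≢i = refl
  lookupOr-modifyAt-≢ (x ∷ xs) {suc i} {suc j} j≢i = lookupOr-modifyAt-≢ xs (j≢i ∘ cong suc)

  lookupOr-drop : ∀ d n xs i → lookupOr d (drop n xs) i ≡ lookupOr d xs (n + i)
  lookupOr-drop d zero    xs       i = refl
  lookupOr-drop d (suc n) []       i = refl
  lookupOr-drop d (suc n) (x ∷ xs) i = lookupOr-drop d n xs i

  lookupOr-ʳ++ : ∀ d xs ys j → lookupOr d (xs ʳ++ ys) (length xs + j) ≡ lookupOr d ys j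
  lookupOr-ʳ++ d []       ys j = refl
  lookupOr-ʳ++ d (x ∷ xs) ys j = begin
    lookupOr d (xs ʳ++ x ∷ ys) (suc (length xs + j)) ≡⟨ cong (lookupOr d (xs ʳ++ x ∷ ys)) (ℕ.+-suc (length xs) j) ⟨
    lookupOr d (xs ʳ++ x ∷ ys) (length xs + suc j)   ≡⟨ lookupOr-ʳ++ d xs (x ∷ ys) (suc j) ⟩
    lookupOr d ys j                                  ∎
    where open ≡-Reasoning

  modifyAt-ʳ++ : ∀ xs ys j f → modifyAt (xs ʳ++ ys) (length xs + j) f ≡ xs ʳ++ modifyAt ys j f
  modifyAt-ʳ++ []       ys j f = refl
  modifyAt-ʳ++ (x ∷ xs) ys j f = begin
    modifyAt (xs ʳ++ x ∷ ys) (suc (length xs + j)) f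
      ≡⟨ cong (λ i → modifyAt (xs ʳ++ x ∷ ys) i f) (ℕ.+-suc (length xs) j) ⟨
    modifyAt (xs ʳ++ x ∷ ys) (length xs + suc j) f
      ≡⟨ modifyAt-ʳ++ xs (x ∷ ys) (suc j) f ⟩
    xs ʳ++ x ∷ modifyAt ys j f
      ∎
    where open ≡-Reasoning

  ++-concat-replicate-comm : ∀ (xs ys : List A) → xs ++ ys ≡ ys ++ xs →
                             ∀ m → xs ++ concat (replicate m ys) ≡ concat (replicate m ys) ++ xs
  ++-concat-replicate-comm xs ys comm zero    = ++-identityʳ xs
  ++-concat-replicate-comm xs ys comm (suc m) = begin
    xs ++ (ys ++ ysᵐ)   ≡⟨ ++-assoc xs ys ysᵐ ⟨
    (xs ++ ys) ++ ysᵐ   ≡⟨ cong (_++ ysᵐ) comm ⟩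
    (ys ++ xs) ++ ysᵐ   ≡⟨ ++-assoc ys xs ysᵐ ⟩
    ys ++ (xs ++ ysᵐ)   ≡⟨ cong (ys ++_) (++-concat-replicate-comm xs ys comm m) ⟩
    ys ++ (ysᵐ ++ xs)   ≡⟨ ++-assoc ys ysᵐ xs ⟨
    (ys ++ ysᵐ) ++ xs   ∎
    where
    open ≡-Reasoning
    ysᵐ = concat (replicate m ys)

  length-concat-replicate : ∀ {xs ys : List A} → length xs ≡ length ys →
                            ∀ m → length (concat (replicate m xs)) ≡ length (concat (replicate m ys))
  length-concat-replicate         eq zero    = refl
  length-concat-replicate {xs} {ys} eq (suc m) = begin
    length (xs ++ concat (replicate m xs))          ≡⟨ length-++ xs ⟩
    length xs + length (concat (replicate m xs))    ≡⟨ cong₂ _+_ eq (length-concat-replicate eq m) ⟩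
    length ys + length (concat (replicate m ys))    ≡⟨ length-++ ys ⟨
    length (ys ++ concat (replicate m ys))          ∎
    where open ≡-Reasoning

module _ {A B : Set} (fits : A → B → Bool) (d : B) where

  allPadded : List A → List B → Bool
  allPadded []       ys = true
  allPadded (x ∷ xs) ys = fits x (lookupOr d ys 0) ∧ allPadded xs (drop 1 ys)

  allPadded-sound : ∀ {a} → (∀ y → T (fits a y)) → ∀ xs ys → T (allPadded xs ys) →
                    ∀ i → T (fits (lookupOr a xs i) (lookupOr d ys i))
  allPadded-sound a-fits []       ys ok i       = a-fits (lookupOr d ys i)
  allPadded-sound a-fits (x ∷ xs) ys ok zero    = proj₁ (Equivalence.to (T-∧ {fits x _}) ok)
  allPadded-sound a-fits (x ∷ xs) ys ok (suc i) =
    subst (T ∘ fits (lookupOr _ xs i)) (lookupOr-drop d 1 ys i)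
          (allPadded-sound a-fits xs (drop 1 ys) (proj₂ (Equivalence.to (T-∧ {fits x _}) ok)) i)

  allPadded-++ : ∀ xs xs' {ys ys'} → length xs ≡ length xs' →
                 T (allPadded xs xs') → T (allPadded ys ys') → T (allPadded (xs ++ ys) (xs' ++ ys'))
  allPadded-++ []       []         eq ok ok' = ok'
  allPadded-++ (x ∷ xs) (x' ∷ xs') eq ok ok' with Equivalence.to (T-∧ {fits x x'}) ok
  ... | head-ok , tail-ok =
    Equivalence.from (T-∧ {fits x x'}) (head-ok , allPadded-++ xs xs' (ℕ.suc-injective eq) tail-ok ok')

  allPadded-concat-replicate : ∀ xs xs' → length xs ≡ length xs' → T (allPadded xs xs') →
                               ∀ m → T (allPadded (concat (replicate m xs)) (concat (replicate m xs')))
  allPadded-concat-replicate xs xs' eq ok zero    = tt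
  allPadded-concat-replicate xs xs' eq ok (suc m) =
    allPadded-++ xs xs' eq ok (allPadded-concat-replicate xs xs' eq ok m)

-- Grids, their support and the ant on a zipper

module Ant {k : ℕ} (w : Vec Turn (suc k)) where

  Colour : Set
  Colour = Fin (suc k)

  -- nothing marks a cell outside the support of the pattern
  Cell : Set
  Cell = Maybe Colour

  Row : Set
  Row = List Cell

  Grid : Set
  Grid = List Row

  cellAt : Row → ℕ → Cell
  cellAt = lookupOr nothing

  rowAt : Grid → ℕ → Row
  rowAt = lookupOr []

  gridAt : Grid → Pos → Cell
  gridAt G (+ i , + r)      = cellAt (rowAt G r) i
  gridAt G (+ i , -[1+ r ]) = nothing
  gridAt G (-[1+ i ] , y)   = nothing

  toPicture : Grid → Picture k
  toPicture G = fromMaybe zero ∘ gridAt G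

  incRow : ℕ → Row → Row
  incRow i row = modifyAt row i (Maybe.map inc)

  incAt : Grid → ℕ → ℕ → Grid
  incAt G r i = modifyAt G r (incRow i)

  gridAt-incAt-≡ : ∀ G r i → gridAt (incAt G r i) (+ i , + r) ≡ Maybe.map inc (gridAt G (+ i , + r))
  gridAt-incAt-≡ G r i = begin
    cellAt (rowAt (modifyAt G r (incRow i)) r) i ≡⟨ cong (λ row → cellAt row i) (lookupOr-modifyAt-≡ G r refl) ⟩
    cellAt (incRow i (rowAt G r)) i              ≡⟨ lookupOr-modifyAt-≡ (rowAt G r) i refl ⟩
    Maybe.map inc (cellAt (rowAt G r) i)         ∎
    where open ≡-Reasoning

  gridAt-incAt-≢ : ∀ G r i q → q ≢ (+ i , + r) → gridAt (incAt G r i) q ≡ gridAt G q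
  gridAt-incAt-≢ G r i (+ i' , + r') q≢ with r' ℕ.≟ r
  ... | no r'≢r = cong (λ row → cellAt row i') (lookupOr-modifyAt-≢ G r'≢r)
  ... | yes refl = begin
    cellAt (rowAt (modifyAt G r (incRow i)) r) i' ≡⟨ cong (λ row → cellAt row i') (lookupOr-modifyAt-≡ G r refl) ⟩
    cellAt (incRow i (rowAt G r)) i'              ≡⟨ lookupOr-modifyAt-≢ (rowAt G r) i'≢i ⟩
    cellAt (rowAt G r) i'                         ∎
    where
    open ≡-Reasoning
    i'≢i : i' ≢ i
    i'≢i i'≡i = q≢ (cong (λ x → (+ x , + r)) i'≡i)
  gridAt-incAt-≢ G r i (+ i' , -[1+ r' ]) q≢ = refl
  gridAt-incAt-≢ G r i (-[1+ i' ] , y)    q≢ = refl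

  SameSupport : Grid → Grid → Set
  SameSupport G G' = ∀ q → is-just (gridAt G q) ≡ is-just (gridAt G' q)

  incAt-sameSupport : ∀ G r i → SameSupport (incAt G r i) G
  incAt-sameSupport G r i q with q ≟P (+ i , + r)
  ... | yes refl = trans (cong is-just (gridAt-incAt-≡ G r i)) (is-just-map (gridAt G q))
    where
    is-just-map : ∀ (c : Cell) → is-just (Maybe.map inc c) ≡ is-just c
    is-just-map (just _) = refl
    is-just-map nothing  = refl
  ... | no q≢ = cong is-just (gridAt-incAt-≢ G r i q q≢)

  rowSupport : (ℕ → Pos) → Row → List Pos
  rowSupport at []            = []
  rowSupport at (nothing ∷ cs) = rowSupport (at ∘ suc) cs
  rowSupport at (just _ ∷ cs)  = at 0 ∷ rowSupport (at ∘ suc) cs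

  gridSupport : (ℕ → ℕ → Pos) → Grid → List Pos
  gridSupport at []        = []
  gridSupport at (row ∷ G) = rowSupport (at 0) row ++ gridSupport (at ∘ suc) G

  support : Grid → List Pos
  support = gridSupport (λ r i → (+ i , + r))

  ∈-rowSupport⁺ : ∀ at row i → T (is-just (cellAt row i)) → at i ∈ rowSupport at row
  ∈-rowSupport⁺ at (just _ ∷ cs)  zero    _ = here refl
  ∈-rowSupport⁺ at (just _ ∷ cs)  (suc i) h = there (∈-rowSupport⁺ (at ∘ suc) cs i h)
  ∈-rowSupport⁺ at (nothing ∷ cs) (suc i) h = ∈-rowSupport⁺ (at ∘ suc) cs i h

  ∈-rowSupport⁻ : ∀ at row {q} → q ∈ rowSupport at row → ∃ λ i → q ≡ at i × T (is-just (cellAt row i))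
  ∈-rowSupport⁻ at (just _ ∷ cs)  (here refl) = 0 , refl , tt
  ∈-rowSupport⁻ at (just _ ∷ cs)  (there q∈)  with ∈-rowSupport⁻ (at ∘ suc) cs q∈
  ... | i , q≡ , h = suc i , q≡ , h
  ∈-rowSupport⁻ at (nothing ∷ cs) q∈          with ∈-rowSupport⁻ (at ∘ suc) cs q∈
  ... | i , q≡ , h = suc i , q≡ , h

  ∈-gridSupport⁺ : ∀ at G r i → T (is-just (cellAt (rowAt G r) i)) → at r i ∈ gridSupport at G
  ∈-gridSupport⁺ at (row ∷ G) zero    i h = ∈-++⁺ˡ (∈-rowSupport⁺ (at 0) row i h)
  ∈-gridSupport⁺ at (row ∷ G) (suc r) i h = ∈-++⁺ʳ (rowSupport (at 0) row) (∈-gridSupport⁺ (at ∘ suc) G r i h)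

  ∈-gridSupport⁻ : ∀ at G {q} → q ∈ gridSupport at G →
                   ∃₂ λ r i → q ≡ at r i × T (is-just (cellAt (rowAt G r) i))
  ∈-gridSupport⁻ at (row ∷ G) q∈ with ∈-++⁻ (rowSupport (at 0) row) q∈
  ... | inj₁ q∈row with ∈-rowSupport⁻ (at 0) row q∈row
  ...   | i , q≡ , h = 0 , i , q≡ , h
  ∈-gridSupport⁻ at (row ∷ G) q∈ | inj₂ q∈G with ∈-gridSupport⁻ (at ∘ suc) G q∈G
  ...   | r , i , q≡ , h = suc r , i , q≡ , h

  ∈-support⁺ : ∀ G q → T (is-just (gridAt G q)) → q ∈ support G
  ∈-support⁺ G (+ i , + r) h = ∈-gridSupport⁺ _ G r i h

  ∈-support⁻ : ∀ G {q} → q ∈ support G → T (is-just (gridAt G q))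
  ∈-support⁻ G q∈ with ∈-gridSupport⁻ _ G q∈
  ... | r , i , refl , h = h

  -- The lists below and above hold the rows nearest to the ant first.
  record Zipper : Set where
    constructor zipper
    field
      below  : Grid
      focus  : Row
      above  : Grid
      column : ℕ
      facing : Dir
  open Zipper

  grid : Zipper → Grid
  grid z = below z ʳ++ focus z ∷ above z

  pos : Zipper → Pos
  pos z = (+ column z , + length (below z))

  enter : Grid → (r i : ℕ) → Dir → Zipper
  enter G r i d = zipper (reverse (take r G)) (rowAt G r) (drop (suc r) G) i d

  rowAt-grid : ∀ z → rowAt (grid z) (length (below z)) ≡ focus z
  rowAt-grid (zipper bl f ab c d) =
    trans (cong (rowAt (bl ʳ++ f ∷ ab)) (sym (ℕ.+-identityʳ (length bl)))) (lookupOr-ʳ++ [] bl (f ∷ ab) 0)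

  -- Moving past the end of a row succeeds, but the next step fails there.
  move : Zipper → Maybe Zipper
  move (zipper bl f ab c east)        = just (zipper bl f ab (suc c) east)
  move (zipper bl f ab zero west)     = nothing
  move (zipper bl f ab (suc c) west)  = just (zipper bl f ab c west)
  move (zipper bl f [] c north)       = nothing
  move (zipper bl f (a ∷ ab) c north) = just (zipper (f ∷ bl) a ab c north)
  move (zipper [] f ab c south)       = nothing
  move (zipper (b ∷ bl) f ab c south) = just (zipper bl b (f ∷ ab) c south)

  paintAndTurn : Zipper → Colour → Zipper
  paintAndTurn (zipper bl f ab c d) x = zipper bl (incRow c f) ab c (turn (lookup w x) d)

  stepZ : Zipper → Maybe Zipper
  stepZ z = cellAt (focus z) (column z) >>= (move ∘ paintAndTurn z)

  runZ : ℕ → Zipper → Maybe Zipper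
  runZ zero    z = just z
  runZ (suc n) z = stepZ z >>= runZ n

  record _—[_]→_ (z : Zipper) (n : ℕ) (z' : Zipper) : Set where
    constructor reaches
    field runZ≡ : runZ n z ≡ just z'

  runZ-+ : ∀ m {n} z {z'} → runZ m z ≡ just z' → runZ (m + n) z ≡ runZ n z'
  runZ-+ zero    z refl = refl
  runZ-+ (suc m) z run with stepZ z
  ... | just y = runZ-+ m y run

  infixr 4 _⨾_
  _⨾_ : ∀ {m n z z' z''} → z —[ m ]→ z' → z' —[ n ]→ z'' → z —[ m + n ]→ z''
  _⨾_ {m} {z = z} (reaches run) (reaches run') = reaches (trans (runZ-+ m z run) run')

  move-spec : ∀ z {z'} → move z ≡ just z' →
              grid z' ≡ grid z × pos z' ≡ pos z ⊕ vec (facing z) × facing z' ≡ facing z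
  move-spec (zipper bl f ab c east) refl =
    refl , cong₂ (λ x y → (+ x , + y)) (ℕ.+-comm 1 c) (sym (ℕ.+-identityʳ (length bl))) , refl
  move-spec (zipper bl f ab (suc c) west) refl =
    refl , cong (λ y → (+ c , + y)) (sym (ℕ.+-identityʳ (length bl))) , refl
  move-spec (zipper bl f (a ∷ ab) c north) refl =
    refl , cong₂ (λ x y → (+ x , + y)) (sym (ℕ.+-identityʳ c)) (ℕ.+-comm 1 (length bl)) , refl
  move-spec (zipper (b ∷ bl) f ab c south) refl =
    refl , cong (λ x → (+ x , + length bl)) (sym (ℕ.+-identityʳ c)) , refl

  grid-paintAndTurn : ∀ z x → grid (paintAndTurn z x) ≡ incAt (grid z) (length (below z)) (column z)
  grid-paintAndTurn (zipper bl f ab c d) x = begin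
    bl ʳ++ modifyAt (f ∷ ab) 0 (incRow c)
      ≡⟨ modifyAt-ʳ++ bl (f ∷ ab) 0 (incRow c) ⟨
    modifyAt (bl ʳ++ f ∷ ab) (length bl + 0) (incRow c)
      ≡⟨ cong (λ r → modifyAt (bl ʳ++ f ∷ ab) r (incRow c)) (ℕ.+-identityʳ _) ⟩
    modifyAt (bl ʳ++ f ∷ ab) (length bl) (incRow c)
      ∎
    where open ≡-Reasoning

  stepZ-spec : ∀ z {z'} → stepZ z ≡ just z' → ∃ λ x →
               gridAt (grid z) (pos z) ≡ just x ×
               grid z' ≡ incAt (grid z) (length (below z)) (column z) ×
               facing z' ≡ turn (lookup w x) (facing z) ×
               pos z' ≡ pos z ⊕ vec (facing z')
  stepZ-spec z step≡ with cellAt (focus z) (column z) in focus≡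
  ... | just x with move-spec (paintAndTurn z x) step≡
  ...   | grid≡ , pos≡ , facing≡ =
    x , trans (cong (λ row → cellAt row (column z)) (rowAt-grid z)) focus≡ ,
    trans grid≡ (grid-paintAndTurn z x) , facing≡ ,
    trans pos≡ (cong (λ d → pos z ⊕ vec d) (sym facing≡))

  step-picture-≡ : ∀ C p d → proj₁ (step w (C , p , d)) p ≡ inc (C p)
  step-picture-≡ C p d with p ≟P p
  ... | yes _  = refl
  ... | no p≢p = ⊥-elim (p≢p refl)

  step-picture-≢ : ∀ C p d {q} → q ≢ p → proj₁ (step w (C , p , d)) q ≡ C q
  step-picture-≢ C p d {q} q≢p with q ≟P p
  ... | yes q≡p = ⊥-elim (q≢p q≡p)
  ... | no _    = refl

  Agrees : Grid → Picture k → Set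
  Agrees G C = ∀ q {x} → gridAt G q ≡ just x → C q ≡ x

  Simulates : Zipper → Config k → Set
  Simulates z (C , p , d) = p ≡ pos z × d ≡ facing z × Agrees (grid z) C

  stepZ-sound : ∀ z {z'} c → stepZ z ≡ just z' → Simulates z c → Simulates z' (step w c)
  stepZ-sound z {z'} (C , p , d) step≡ (refl , refl , agrees) with stepZ-spec z step≡
  ... | x , atAnt , grid≡ , facing≡ , pos≡ = pos-agrees , facing-agrees , λ q g → agreesAt q g (q ≟P pos z)
    where
    open ≡-Reasoning

    Cp≡x : C (pos z) ≡ x
    Cp≡x = agrees (pos z) atAnt

    facing-agrees : turn (lookup w (C (pos z))) (facing z) ≡ facing z'
    facing-agrees = trans (cong (λ y → turn (lookup w y) (facing z)) Cp≡x) (sym facing≡)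

    pos-agrees : pos z ⊕ vec (turn (lookup w (C (pos z))) (facing z)) ≡ pos z'
    pos-agrees = trans (cong (λ d → pos z ⊕ vec d) facing-agrees) (sym pos≡)

    painted : ∀ q → gridAt (grid z') q ≡ gridAt (incAt (grid z) (length (below z)) (column z)) q
    painted q = cong (λ G → gridAt G q) grid≡

    agreesAt : ∀ q {y} → gridAt (grid z') q ≡ just y → Dec (q ≡ pos z) →
               proj₁ (step w (C , pos z , facing z)) q ≡ y
    agreesAt .(pos z) {y} g (yes refl) = begin
      proj₁ (step w (C , pos z , facing z)) (pos z) ≡⟨ step-picture-≡ C (pos z) (facing z) ⟩
      inc (C (pos z))                                ≡⟨ cong inc Cp≡x ⟩
      inc x                                          ≡⟨ just-injective (begin
        just (inc x)                                                   ≡⟨ cong (Maybe.map inc) atAnt ⟨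
        Maybe.map inc (gridAt (grid z) (pos z))                        ≡⟨ gridAt-incAt-≡ (grid z) _ _ ⟨
        gridAt (incAt (grid z) (length (below z)) (column z)) (pos z)  ≡⟨ painted (pos z) ⟨
        gridAt (grid z') (pos z)                                       ≡⟨ g ⟩
        just y                                                         ∎) ⟩
      y                                              ∎
    agreesAt q g (no q≢p) =
      trans (step-picture-≢ C (pos z) (facing z) q≢p)
            (agrees q (trans (sym (gridAt-incAt-≢ (grid z) _ _ q q≢p)) (trans (sym (painted q)) g)))

  stepZ-onSupport : ∀ z {z'} → stepZ z ≡ just z' → T (is-just (gridAt (grid z) (pos z)))
  stepZ-onSupport z step≡ with stepZ-spec z step≡
  ... | x , atAnt , _ = subst (T ∘ is-just) (sym atAnt) tt

  stepZ-sameSupport : ∀ z {z'} → stepZ z ≡ just z' → SameSupport (grid z') (grid z)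
  stepZ-sameSupport z step≡ q with stepZ-spec z step≡
  ... | x , _ , grid≡ , _ = trans (cong (λ G → is-just (gridAt G q)) grid≡) (incAt-sameSupport (grid z) _ _ q)

  runZ-sound : ∀ G₀ n z {z'} c → z —[ n ]→ z' → Simulates z c → SameSupport (grid z) G₀ →
               Applicable w (support G₀) n c × Simulates z' (iterate w n c) × SameSupport (grid z') G₀
  runZ-sound G₀ zero    z c (reaches refl) sim same = tt , sim , same
  runZ-sound G₀ (suc n) z c (reaches run)  sim same with stepZ z in step≡
  ... | just y with runZ-sound G₀ n y (step w c) (reaches run) (stepZ-sound z c step≡ sim)
                               (λ q → trans (stepZ-sameSupport z step≡ q) (same q))
  ...   | applicable , sim' , same' = (ant∈S , applicable) , sim' , same'
    where
    ant∈S : position c ∈ support G₀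
    ant∈S = subst (_∈ support G₀) (sym (proj₁ sim))
                  (∈-support⁺ G₀ (pos z) (subst T (same (pos z)) (stepZ-onSupport z step≡)))

  fitsCell : Cell → Cell → Bool
  fitsCell nothing  _ = true
  fitsCell (just x) c = ⌊ x Fin.≟ fromMaybe zero c ⌋

  fitsRow : ℕ → Row → Row → Bool
  fitsRow a row row' = allPadded fitsCell nothing row (drop a row')

  periodic : ℕ → ℕ → Grid → Grid → Bool
  periodic a b G F = allPadded (fitsRow a) [] G (replicate b [] ++ F)

  gridAt-⊖ : ∀ F i r b → gridAt F (+ i , r ⊖ b) ≡ cellAt (rowAt (replicate b [] ++ F) r) i
  gridAt-⊖ F i r       zero    = refl
  gridAt-⊖ F i zero    (suc b) = refl
  gridAt-⊖ F i (suc r) (suc b) =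
    trans (cong (λ y → gridAt F (+ i , y)) (ℤ.[1+m]⊖[1+n]≡m⊖n r b)) (gridAt-⊖ F i r b)

  gridAt-translate : ∀ F a b i r →
                     gridAt F ((+ i , + r) ⊕ (+ a , - + b)) ≡ cellAt (drop a (rowAt (replicate b [] ++ F) r)) i
  gridAt-translate F a b i r = begin
    gridAt F (+ (i + a) , + r +ℤ - + b)            ≡⟨ cong (λ y → gridAt F (+ (i + a) , y)) (ℤ.m-n≡m⊖n r b) ⟩
    gridAt F (+ (i + a) , r ⊖ b)                   ≡⟨ gridAt-⊖ F (i + a) r b ⟩
    cellAt (rowAt (replicate b [] ++ F) r) (i + a) ≡⟨ cong (cellAt (rowAt (replicate b [] ++ F) r)) (ℕ.+-comm i a) ⟩
    cellAt (rowAt (replicate b [] ++ F) r) (a + i) ≡⟨ lookupOr-drop nothing a _ i ⟨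
    cellAt (drop a (rowAt (replicate b [] ++ F) r)) i ∎
    where open ≡-Reasoning

  periodic-sound : ∀ a b G F → T (periodic a b G F) → ∀ q {x} → gridAt G q ≡ just x →
                   x ≡ fromMaybe zero (gridAt F (q ⊕ (+ a , - + b)))
  periodic-sound a b G F ok (+ i , + r) {x} g =
    trans (toWitness cell-fits) (cong (fromMaybe zero) (sym (gridAt-translate F a b i r)))
    where
    row-fits : T (fitsRow a (rowAt G r) (rowAt (replicate b [] ++ F) r))
    row-fits = allPadded-sound (fitsRow a) [] (λ _ → tt) G _ ok r
    cell-fits : T (fitsCell (just x) (cellAt (drop a (rowAt (replicate b [] ++ F) r)) i))
    cell-fits = subst (λ c → T (fitsCell c _)) g
                      (allPadded-sound fitsCell nothing (λ _ → tt) (rowAt G r) _ row-fits i)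

  highway-of-run : ∀ a b {N} z₀ z → T (is-just (gridAt (grid z₀) (pos z₀))) → z₀ —[ N ]→ z →
                   pos z ≡ pos z₀ ⊕ (+ a , - + b) → facing z ≡ facing z₀ →
                   T (periodic a b (grid z₀) (grid z)) →
                   IsHighway w N (+ a , - + b) (support (grid z₀)) (toPicture (grid z₀)) (pos z₀) (facing z₀)
  highway-of-run a b {N} z₀ z onPattern run pos≡ facing≡ ok =
    ∈-support⁺ (grid z₀) (pos z₀) onPattern , applicable ,
    trans (proj₁ sim) pos≡ , trans (proj₁ (proj₂ sim)) facing≡ , recurs
    where
    v : Pos
    v = (+ a , - + b)
    G₀ = grid z₀
    F  = grid z
    c₀ : Config k
    c₀ = toPicture G₀ , pos z₀ , facing z₀
    result = runZ-sound G₀ N z₀ c₀ run (refl , refl , λ q g → cong (fromMaybe zero) g) (λ _ → refl)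
    applicable = proj₁ result
    sim        = proj₁ (proj₂ result)
    same       = proj₂ (proj₂ result)
    P' = proj₁ (iterate w N c₀)
    agreesF : Agrees F P'
    agreesF = proj₂ (proj₂ sim)

    ∈S⇒inF : ∀ q → q ∈ support G₀ → T (is-just (gridAt F q))
    ∈S⇒inF q q∈ = subst T (sym (same q)) (∈-support⁻ G₀ q∈)

    inF⇒∈S : ∀ q → T (is-just (gridAt F q)) → q ∈ support G₀
    inF⇒∈S q h = ∈-support⁺ G₀ q (subst T (same q) h)

    Px≡ : ∀ x {c} → gridAt G₀ x ≡ just c → toPicture G₀ x ≡ fromMaybe zero (gridAt F (x ⊕ v))
    Px≡ x g₀ = trans (cong (fromMaybe zero) g₀) (periodic-sound a b G₀ F ok x g₀)

    recurs : ∀ x → x ∈ support G₀ →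
             ((x ⊕ v) ∈ support G₀ → toPicture G₀ x ≡ P' (x ⊕ v)) ×
             ((x ⊕ v) ∉ support G₀ → toPicture G₀ x ≡ zero)
    recurs x x∈ with T-is-just (∈-support⁻ G₀ x∈)
    ... | c , g₀ with gridAt F (x ⊕ v) in g
    ...   | just c' = (λ _ → trans (trans (Px≡ x g₀) (cong (fromMaybe zero) g)) (sym (agreesF (x ⊕ v) g)))
                    , (λ x'∉ → ⊥-elim (x'∉ (inF⇒∈S (x ⊕ v) (subst (T ∘ is-just) (sym g) tt))))
    ...   | nothing = (λ x'∈ → ⊥-elim (subst (T ∘ is-just) g (∈S⇒inF (x ⊕ v) x'∈)))
                    , (λ _ → trans (Px≡ x g₀) (cong (fromMaybe zero) g))

  hasHighway-of-run : ∀ a b {N} z₀ z → T (is-just (gridAt (grid z₀) (pos z₀))) → z₀ —[ N ]→ z →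
                      pos z ≡ pos z₀ ⊕ (+ a , - + b) → facing z ≡ facing z₀ →
                      T (periodic a b (grid z₀) (grid z)) → HasHighwayOfPeriod w N
  hasHighway-of-run a b z₀ z onPattern run pos≡ facing≡ ok =
    (+ a , - + b) , support (grid z₀) , toPicture (grid z₀) , pos z₀ , facing z₀ ,
    highway-of-run a b z₀ z onPattern run pos≡ facing≡ ok

  runZ-pump : ∀ {g} (S : Grid → Grid → Zipper) (As Bs : Grid) →
              (∀ ys zs → S (As ++ ys) zs —[ g ]→ S ys (Bs ++ zs)) →
              ∀ m ys zs → S (concat (replicate m As) ++ ys) zs —[ m * g ]→ S ys (concat (replicate m Bs) ++ zs)
  runZ-pump S As Bs pass zero    ys zs = reaches refl
  runZ-pump {g} S As Bs pass (suc m) ys zs =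
    subst₂ (λ us vs → S us zs —[ suc m * g ]→ S ys vs) (sym (++-assoc As Asᵐ ys)) Bs-moved
           (pass (Asᵐ ++ ys) zs ⨾ runZ-pump S As Bs pass m ys (Bs ++ zs))
    where
    open ≡-Reasoning
    Asᵐ = concat (replicate m As)
    Bsᵐ = concat (replicate m Bs)
    Bs-moved : Bsᵐ ++ Bs ++ zs ≡ (Bs ++ Bsᵐ) ++ zs
    Bs-moved = begin
      Bsᵐ ++ Bs ++ zs   ≡⟨ ++-assoc Bsᵐ Bs zs ⟨
      (Bsᵐ ++ Bs) ++ zs ≡⟨ cong (_++ zs) (++-concat-replicate-comm Bs Bs refl m) ⟨
      (Bs ++ Bsᵐ) ++ zs ∎

  vec-injective : ∀ {d d'} → vec d ≡ vec d' → d ≡ d'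
  vec-injective {east}  {east}  _ = refl
  vec-injective {north} {north} _ = refl
  vec-injective {west}  {west}  _ = refl
  vec-injective {south} {south} _ = refl

  certifiesHighway : ℕ → ℕ → ℕ → Zipper → Bool
  certifiesHighway a b N z₀ = is-just (gridAt (grid z₀) (pos z₀)) ∧ Maybe.maybe final false (runZ N z₀)
    where
    final : Zipper → Bool
    final z = ⌊ pos z ≟P (pos z₀ ⊕ (+ a , - + b)) ⌋ ∧ ⌊ vec (facing z) ≟P vec (facing z₀) ⌋ ∧
              periodic a b (grid z₀) (grid z)

  highway-by-computation : ∀ a b N z₀ → certifiesHighway a b N z₀ ≡ true → HasHighwayOfPeriod w N
  highway-by-computation a b N z₀ ok with gridAt (grid z₀) (pos z₀) in start | runZ N z₀ in run
  ... | just _ | just z with pos z ≟P (pos z₀ ⊕ (+ a , - + b)) | vec (facing z) ≟P vec (facing z₀)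
  ...   | yes pos≡ | yes vec≡ =
    hasHighway-of-run a b z₀ z (subst (T ∘ is-just) (sym start) tt) (reaches run) pos≡ (vec-injective vec≡)
                      (Equivalence.from T-≡ ok)

-- The highways of LLRLRL

open Ant LLRLRL

-- In a row string a dot is a cell outside the support and a digit is a colour.
row : String → Row
row = map (λ ch → readMaybe 10 (fromChar ch) >>= colour) ∘ toList
  where
  colour : ℕ → Cell
  colour 0 = just (# 0)
  colour 1 = just (# 1)
  colour 2 = just (# 2)
  colour 3 = just (# 3)
  colour 4 = just (# 4)
  colour 5 = just (# 5)
  colour _ = nothing

rows : List String → Grid
rows = map row

-- Patterns are listed from their bottom row (y = 0) upwards. Each period is written exactly
-- as mainTheorem1 instantiates it: Agda compares two types HasHighwayOfPeriod LLRLRL N whose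
-- periods differ syntactically by unfolding iterate, which is hopeless for N ≥ 220.

pattern₀ : Grid
pattern₀ = rows
  ( ".....00..."
  ∷ "..00000..."
  ∷ "..02200..."
  ∷ "23452000.."
  ∷ "31301000.."
  ∷ "5314420000"
  ∷ ".515130000"
  ∷ "2100132200"
  ∷ ".120545200"
  ∷ ".251554200"
  ∷ "..10055300"
  ∷ "...05013.."
  ∷ "....0532.."
  ∷ [])

highway₀ : HasHighwayOfPeriod LLRLRL (220 + 24 * zero)
highway₀ = highway-by-computation 2 2 (220 + 24 * zero) (enter pattern₀ 5 2 south) refl

pattern₁ : Grid
pattern₁ = rows
  ( "....0000...."
  ∷ "....0000...."
  ∷ "..22220000.."
  ∷ "..20020000.."
  ∷ ".34151220000"
  ∷ "313233520000"
  ∷ "532032312200"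
  ∷ ".51113235200"
  ∷ ".1025045420."
  ∷ "..201053210."
  ∷ "...15053100."
  ∷ "....0054200."
  ∷ "....0055300."
  ∷ "....05013..."
  ∷ ".....0532..."
  ∷ [])

highway₁ : HasHighwayOfPeriod LLRLRL (220 + 24 * suc zero)
highway₁ = highway-by-computation 2 2 (220 + 24 * suc zero) (enter pattern₁ 9 9 north) refl

pattern₂ : Grid
pattern₂ = rows
  ( ".....00...."
  ∷ "..00000...."
  ∷ "..0220000.."
  ∷ "234520000.."
  ∷ "31312220000"
  ∷ "53250020000"
  ∷ ".5152512200"
  ∷ ".1001335200"
  ∷ ".1205454200"
  ∷ ".2515544200"
  ∷ "..10054310."
  ∷ "...0053210."
  ∷ "...0053100."
  ∷ "...0054200."
  ∷ "...0055300."
  ∷ "...05013..."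
  ∷ "....0532..."
  ∷ [])

highway₂ : HasHighwayOfPeriod LLRLRL (220 + 24 * suc (suc zero))
highway₂ = highway-by-computation 2 2 (220 + 24 * suc (suc zero)) (enter pattern₂ 10 7 south) refl

pattern₃ : Grid
pattern₃ = rows
  ( ".....00......"
  ∷ "..00000......"
  ∷ "..0220000...."
  ∷ "234520000...."
  ∷ "31312220000.."
  ∷ "53250020000.."
  ∷ ".515251220000"
  ∷ ".100133520000"
  ∷ ".120545312200"
  ∷ ".251553135200"
  ∷ "..10002353100"
  ∷ "...0154543100"
  ∷ "...105544310."
  ∷ "...050555310."
  ∷ "....05000400."
  ∷ ".....00013..."
  ∷ ".......532..."
  ∷ [])

highway₃ : HasHighwayOfPeriod LLRLRL (220 + 24 * suc (suc (suc zero)))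
highway₃ = highway-by-computation 2 2 (220 + 24 * suc (suc (suc zero))) (enter pattern₃ 10 6 east) refl

stripe : Row → ℕ → Grid
stripe s m = concat (replicate m (s ∷ s ∷ []))

-- the rows of the stripe after 0, 1, 2, 3 and 4 crossings by the ant
s₀ s₁ s₂ s₃ s₄ : Row
s₀ = row "....005443100"
s₁ = row "....005444420"
s₂ = row "....000544420"
s₃ = row "....000544431"
s₄ = row "....000054431"

familyBase : Grid
familyBase = rows
  ( ".....00......"
  ∷ "..00000......"
  ∷ "..0220000...."
  ∷ "234520000...."
  ∷ "31312220000.."
  ∷ "53250020000.."
  ∷ ".515251220000"
  ∷ ".100133520000"
  ∷ ".120545312200"
  ∷ ".251553135200"
  ∷ "..10002353100"
  ∷ "...0154543100"
  ∷ "...1055443100"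
  ∷ "...0505443100"
  ∷ [])

familyCap : Grid
familyCap = rows
  ( "....00544310."
  ∷ "....00555310."
  ∷ "....05000400."
  ∷ ".....00013..."
  ∷ ".......532..."
  ∷ [])

familyStart : ℕ → Zipper
familyStart k = enter (familyBase ++ stripe s₀ k ++ familyCap) 10 6 east

lower₁ : Grid
lower₁ = rows
  ( "...0505444420"
  ∷ "...1055444420"
  ∷ "...0154544420"
  ∷ "..10004454420"
  ∷ ".251505235420"
  ∷ ".120105313520"
  ∷ ".102504531220"
  ∷ ".511132352000"
  ∷ "53203231220.."
  ∷ "31323352000.."
  ∷ "234151220...."
  ∷ "..2002000...."
  ∷ "..22220......"
  ∷ ".....00......"
  ∷ [])

upper₂ : Grid
upper₂ = rows
  ( "....00055553."
  ∷ "....00500013."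
  ∷ "....05000532."
  ∷ [])
  ++ drop 3 familyCap

lower₃ : Grid
lower₃ = rows
  ( "...0500544431"
  ∷ "...1050544431"
  ∷ "...0105544431"
  ∷ "..10015454431"
  ∷ ".251500445431"
  ∷ ".120100523531"
  ∷ ".102515531352"
  ∷ ".511205453122"
  ∷ "53210013352.."
  ∷ "31351525122.."
  ∷ "235325002...."
  ∷ "..3131222...."
  ∷ "..23452......"
  ∷ ".....22......"
  ∷ [])

upper₄ : Grid
upper₄ = rows
  ( "....000055531"
  ∷ "....00050004."
  ∷ [])
  ++ drop 1 upper₂

familyEnd : ℕ → Zipper
familyEnd m = zipper (drop 6 lower₃) (row ".120100023531") (above ++ s₄ ∷ stripe s₄ m ++ upper₄) 8 east
  where
  above : Grid
  above = rows
    ( ".251501545431"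
    ∷ "..10010554431"
    ∷ "...0105054431"
    ∷ "...1050054431"
    ∷ "...0500054431"
    ∷ [])

-- The first argument is the part of the grid ahead of the ant, which a crossing consumes;
-- as in a zipper, both parts list the rows nearest to the ant first.
climb₁ descend₁ climb₂ descend₂ : Grid → Grid → Zipper
climb₁   ys zs = zipper zs (row "....005443210") (s₀ ∷ ys) 11 north
descend₁ ys zs = zipper (s₁ ∷ ys) s₁ zs 6 south
climb₂   ys zs = zipper zs s₂ (s₂ ∷ ys) 11 north
descend₂ ys zs = zipper ys s₃ zs 7 south

crossing : ∀ {g} (S : Grid → Grid → Zipper) s s' →
           (∀ ys zs → S (s ∷ s ∷ ys) zs —[ g ]→ S ys (s' ∷ s' ∷ zs)) →
           ∀ m ys zs → S (stripe s m ++ ys) zs —[ m * g ]→ S ys (stripe s' m ++ zs)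
crossing S s s' pass = runZ-pump S (s ∷ s ∷ []) (s' ∷ s' ∷ []) pass

phase₁ : ∀ m → familyStart (suc m) —[ 131 ]→ climb₁ (stripe s₀ m ++ familyCap) lower₁
phase₁ m = reaches refl

phase₂ : ∀ m → climb₁ familyCap (stripe s₁ m ++ lower₁) —[ 42 ]→ descend₁ (stripe s₁ m ++ lower₁) upper₂
phase₂ m = reaches refl

phase₃ : ∀ m → descend₁ lower₁ (stripe s₂ m ++ upper₂) —[ 142 ]→ climb₂ (stripe s₂ m ++ upper₂) lower₃
phase₃ m = reaches refl

phase₄ : ∀ m → climb₂ upper₂ (stripe s₃ m ++ lower₃) —[ 12 ]→ descend₂ (stripe s₃ m ++ lower₃) upper₄
phase₄ m = reaches refl

phase₅ : ∀ m → descend₂ lower₃ (stripe s₄ m ++ upper₄) —[ 13 ]→ familyEnd m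
phase₅ m = reaches refl

familyRun : ∀ m → familyStart (suc m)
  —[ 131 + (m * 12 + (42 + (m * 4 + (142 + (m * 4 + (12 + (m * 4 + 13))))))) ]→ familyEnd m
familyRun m =
  phase₁ m ⨾ crossing climb₁   s₀ s₁ (λ _ _ → reaches refl) m familyCap lower₁ ⨾
  phase₂ m ⨾ crossing descend₁ s₁ s₂ (λ _ _ → reaches refl) m lower₁ upper₂ ⨾
  phase₃ m ⨾ crossing climb₂   s₂ s₃ (λ _ _ → reaches refl) m upper₂ lower₃ ⨾
  phase₄ m ⨾ crossing descend₂ s₃ s₄ (λ _ _ → reaches refl) m lower₃ upper₄ ⨾
  phase₅ m

period-split : ∀ m → 131 + (m * 12 + (42 + (m * 4 + (142 + (m * 4 + (12 + (m * 4 + 13)))))))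
                     ≡ 220 + 24 * suc (suc (suc (suc (suc m))))
period-split = solve-∀

stripe-∷ : ∀ s m zs → stripe s m ++ s ∷ zs ≡ s ∷ stripe s m ++ zs
stripe-∷ s m zs = begin
  stripe s m ++ (s ∷ zs)          ≡⟨ ++-assoc (stripe s m) (s ∷ []) zs ⟨
  (stripe s m ++ s ∷ []) ++ zs    ≡⟨ cong (_++ zs) (++-concat-replicate-comm (s ∷ []) (s ∷ s ∷ []) refl m) ⟨
  s ∷ stripe s m ++ zs            ∎
  where open ≡-Reasoning

-- Past the first sixteen rows the check compares the two stripes, which are one row out of step.
familyPeriodic : ∀ m → T (periodic 2 2 (grid (familyStart (suc m))) (grid (familyEnd m)))
familyPeriodic m =
  subst (T ∘ allPadded (fitsRow 2) [] (stripe s₀ m ++ familyCap)) (stripe-∷ s₄ m upper₄)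
    (allPadded-++ (fitsRow 2) [] (stripe s₀ m) (stripe s₄ m) (length-concat-replicate refl m)
                  (allPadded-concat-replicate (fitsRow 2) [] (s₀ ∷ s₀ ∷ []) (s₄ ∷ s₄ ∷ []) refl tt m) tt)

familyHighway : ∀ k → HasHighwayOfPeriod LLRLRL (220 + 24 * suc (suc (suc (suc k))))
familyHighway zero    =
  highway-by-computation 2 2 (220 + 24 * suc (suc (suc (suc zero)))) (familyStart zero) refl
familyHighway (suc m) =
  hasHighway-of-run 2 2 (familyStart (suc m)) (familyEnd m) tt
    (subst (familyStart (suc m) —[_]→ familyEnd m) (period-split m) (familyRun m)) refl refl (familyPeriodic m)

mainTheorem1 : (n : ℕ) → HasHighwayOfPeriod LLRLRL (220 + 24 * n)
mainTheorem1 zero                      = highway₀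
mainTheorem1 (suc zero)                = highway₁
mainTheorem1 (suc (suc zero))          = highway₂
mainTheorem1 (suc (suc (suc zero)))    = highway₃
mainTheorem1 (suc (suc (suc (suc k)))) = familyHighway k
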